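{- Let $A(x)=a_1x+a_0\in\mathbb{Z}[x]$ with $a_1\neq0$ and $\gcd(a_0,a_1)=1$. Let $B(x)=x^e+b_{e-1}x^{e-1}+\cdots+b_0\in\mathbb{Z}[x]$ be a monic polynomial coprime with $A(x)$, let $\Delta$ be the resultant of $A$ and $B$, let $p$ be a prime and $\omega=\nu_p(\Delta)$. Then there exists an integer $c$ such that for all $n\in\mathbb{Z}$, $$\gcd\big(A(n),B(n),p^\omega\big)=\gcd\big(n-c,p^\omega\big).$$ (That is, the pattern of the sequence $\gcd(A(n),B(n),p^\omega)$ is the basic pattern $[\gcd(n,p^\omega)]$ of length $p^\omega$ up to circular permutation.)
   Context: For $A(x)=a_1x+a_0$ with $a_1\ne 0$ and $B$ monic of degree $e$, the resultant is the determinant of the Sylvester matrix of $A$ and $B$; equivalently $\Delta=a_1^e\,B(-a_0/a_1)$. $\nu_p$ denotes the $p$-adic valuation. -}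

module Defs where

open import Data.Nat as ℕ using (ℕ; zero; suc)
open import Data.Integer using (ℤ; +_; -_; _+_; _*_; _^_; 0ℤ; 1ℤ)
open import Data.Integer.GCD using (gcd)
open import Data.List using (List; []; _∷_)
open import Data.Vec using (Vec; []; _∷_)
open import Data.Integer.Divisibility using (_∣_)
open import Relation.Nullary using (¬_)
open import Relation.Binary.PropositionalEquality using (_≡_)

evalList : List ℤ → ℤ → ℤ
evalList []       x = 0ℤ
evalList (c ∷ cs) x = c + x * evalList cs x

-- Coefficients of a monic polynomial x^e + b_{e-1}x^{e-1} + ⋯ + b₀,
-- given the vector bs = [b₀, …, b_{e-1}] of non-leading coefficients.
monicCoeffs : ∀ {e} → Vec ℤ e → List ℤ
monicCoeffs []       = 1ℤ ∷ []
monicCoeffs (b ∷ bs) = b ∷ monicCoeffs bs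

evalMonic : ∀ {e} → Vec ℤ e → ℤ → ℤ
evalMonic bs = evalList (monicCoeffs bs)

evalLin : ℤ → ℤ → ℤ → ℤ
evalLin a₁ a₀ n = a₁ * n + a₀

-- Homogenised evaluation: for coefficients [c₀,…,c_k] and a degree
-- bound d with k ≤ d, hom d cs u v = Σ_i c_i u^i v^(d-i).
hom : ℕ → List ℤ → ℤ → ℤ → ℤ
hom d       []       u v = 0ℤ
hom d       (c ∷ cs) u v = c * (v ^ d) + u * hom (d ℕ.∸ 1) cs u v

-- Resultant of A = a₁x + a₀ and monic B of degree e:
-- Δ = a₁^e B(-a₀/a₁) = Σ_{i=0}^{e} b_i (-a₀)^i a₁^(e-i)   (b_e = 1).
resultant : ℤ → ℤ → ∀ {e} → Vec ℤ e → ℤ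
resultant a₁ a₀ {e} bs = hom e (monicCoeffs bs) (- a₀) a₁

-- A and B coprime in ℤ[x]: since A is primitive of degree 1 its only
-- non-constant divisors are ±A, so coprimality means A ∤ B in ℤ[x],
-- i.e. there is no integer polynomial Q with B = A · Q
-- (polynomial identity, checked as functions on the infinite ring ℤ).
CoprimeLinMonic : ℤ → ℤ → ∀ {e} → Vec ℤ e → Set
CoprimeLinMonic a₁ a₀ bs =
  ¬ (Data.Product.Σ (List ℤ) λ Q → ∀ n → evalMonic bs n ≡ evalLin a₁ a₀ n * evalList Q n)
  where import Data.Product

IsValuation : ℕ → ℤ → ℕ → Set
IsValuation p x ω = ((+ p) ^ ω ∣ x) Data.Product.× (¬ ((+ p) ^ suc ω ∣ x))
  where import Data.Product

-- Write q = p^ω, so q ∣ Δ.  If ω > 0 then p ∤ a₁: otherwise Δ ≡ (-a₀)^e (mod p)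
-- would force p ∣ a₀.  Hence a₁ has an inverse s modulo q, and c = -s a₀ is a
-- root of A modulo q; dehomogenising Δ = a₁^e B(-a₀/a₁) gives s^e Δ ≡ B(c), so
-- c is a root of B modulo q as well.  For every divisor d of q we then have
-- d ∣ A(n) ⇔ d ∣ n - c, and d ∣ n - c ⇒ d ∣ B(n) because B(n) ≡ B(c) (mod d),
-- so both gcds have the same divisors below q.
module Submission where

open import Defs
open import Data.Nat using (ℕ)
open import Data.Nat.Primality using (Prime)
open import Data.Integer using (ℤ; +_; 0ℤ; 1ℤ; _-_; _^_)
open import Data.Integer.GCD using (gcd)
open import Data.Vec using (Vec)
open import Data.Product using (Σ)
open import Relation.Nullary using (¬_)
open import Relation.Binary.PropositionalEquality using (_≡_)

import Data.Nat as ℕ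
import Data.Nat.Divisibility as ℕ
import Data.Nat.GCD as ℕ
open import Data.Nat.Coprimality as Coprimality using (Coprime; coprime-Bézout; coprime-divisor)
open import Data.Nat.Primality using (euclidsLemma; prime⇒irreducible; ¬prime[1])
open import Data.Integer using (-_; _+_; _*_; ∣_∣; -[1+_])
import Data.Integer.Properties as ℤ
import Data.Integer.GCD as ℤ
import Data.Integer.Divisibility as Unsigned
open import Data.Integer.Divisibility.Signed
open import Data.Integer.Tactic.RingSolver using (solve-∀)
open import Data.List using (List; []; _∷_)
open import Data.Vec using ([]; _∷_)
open import Data.Product using (_,_; _×_; proj₁; proj₂)
open import Data.Sum using (_⊎_; inj₁; inj₂)
open import Level using (0ℓ)
open import Relation.Binary.Bundles using (Setoid)
open import Relation.Nullary using (contradiction)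
open import Relation.Binary.PropositionalEquality
  using (refl; sym; trans; cong; subst; module ≡-Reasoning)

infix 4 _≡_mod_

record _≡_mod_ (x y m : ℤ) : Set where
  constructor ∣⇒≡-mod
  field ≡-mod⇒∣ : m ∣ x - y

open _≡_mod_

≡⇒≡-mod : ∀ {m x y} → x ≡ y → x ≡ y mod m
≡⇒≡-mod {x = x} refl = ∣⇒≡-mod (divides 0ℤ (ℤ.+-inverseʳ x))

≡-mod-refl : ∀ {m} x → x ≡ x mod m
≡-mod-refl x = ≡⇒≡-mod refl

≡-mod-sym : ∀ {m x y} → x ≡ y mod m → y ≡ x mod m
≡-mod-sym {x = x} {y} (∣⇒≡-mod m∣x-y) = ∣⇒≡-mod (subst (_ ∣_) (negate x y) (∣m⇒∣-m m∣x-y))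
  where
  negate : ∀ x y → - (x - y) ≡ y - x
  negate = solve-∀

≡-mod-trans : ∀ {m x y z} → x ≡ y mod m → y ≡ z mod m → x ≡ z mod m
≡-mod-trans {x = x} {y} {z} (∣⇒≡-mod m∣x-y) (∣⇒≡-mod m∣y-z) =
  ∣⇒≡-mod (subst (_ ∣_) (telescope x y z) (∣m∣n⇒∣m+n m∣x-y m∣y-z))
  where
  telescope : ∀ x y z → (x - y) + (y - z) ≡ x - z
  telescope = solve-∀

≡-mod-setoid : ℤ → Setoid 0ℓ 0ℓ
≡-mod-setoid m = record
  { Carrier       = ℤ
  ; _≈_           = λ x y → x ≡ y mod m
  ; isEquivalence = record
    { refl  = ≡-mod-refl _
    ; sym   = ≡-mod-sym
    ; trans = ≡-mod-trans
    }
  }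

module ≡-mod-Reasoning (m : ℤ) where
  open import Relation.Binary.Reasoning.Setoid (≡-mod-setoid m) public

+-cong-mod : ∀ {m x y u v} → x ≡ y mod m → u ≡ v mod m → x + u ≡ y + v mod m
+-cong-mod {x = x} {y} {u} {v} (∣⇒≡-mod x≡y) (∣⇒≡-mod u≡v) =
  ∣⇒≡-mod (subst (_ ∣_) (regroup x y u v) (∣m∣n⇒∣m+n x≡y u≡v))
  where
  regroup : ∀ x y u v → (x - y) + (u - v) ≡ (x + u) - (y + v)
  regroup = solve-∀

*-cong-mod : ∀ {m x y u v} → x ≡ y mod m → u ≡ v mod m → x * u ≡ y * v mod m
*-cong-mod {x = x} {y} {u} {v} (∣⇒≡-mod x≡y) (∣⇒≡-mod u≡v) =
  ∣⇒≡-mod (subst (_ ∣_) (regroup x y u v) (∣m∣n⇒∣m+n (∣n⇒∣m*n x u≡v) (∣m⇒∣m*n v x≡y)))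
  where
  regroup : ∀ x y u v → x * (u - v) + (x - y) * v ≡ x * u - y * v
  regroup = solve-∀

^-cong-mod : ∀ {m x y} k → x ≡ y mod m → x ^ k ≡ y ^ k mod m
^-cong-mod ℕ.zero    x≡y = ≡⇒≡-mod refl
^-cong-mod (ℕ.suc k) x≡y = *-cong-mod x≡y (^-cong-mod k x≡y)

≡-mod-weaken : ∀ {d m x y} → d ∣ m → x ≡ y mod m → x ≡ y mod d
≡-mod-weaken d∣m (∣⇒≡-mod m∣x-y) = ∣⇒≡-mod (∣-trans d∣m m∣x-y)

∣⇒≡0-mod : ∀ {m x} → m ∣ x → x ≡ 0ℤ mod m
∣⇒≡0-mod {x = x} m∣x = ∣⇒≡-mod (subst (_ ∣_) (sym (ℤ.+-identityʳ x)) m∣x)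

∣-resp-≡-mod : ∀ {m x y} → x ≡ y mod m → m ∣ x → m ∣ y
∣-resp-≡-mod {x = x} {y} (∣⇒≡-mod m∣x-y) m∣x = subst (_ ∣_) (cancel x y) (∣m∣n⇒∣m-n m∣x m∣x-y)
  where
  cancel : ∀ x y → x - (x - y) ≡ y
  cancel = solve-∀

^-distribʳ-* : ∀ x y k → (x * y) ^ k ≡ x ^ k * y ^ k
^-distribʳ-* x y ℕ.zero    = refl
^-distribʳ-* x y (ℕ.suc k) =
  trans (cong (x * y *_) (^-distribʳ-* x y k)) (interchange x y (x ^ k) (y ^ k))
  where
  interchange : ∀ x y X Y → x * y * (X * Y) ≡ x * X * (y * Y)
  interchange = solve-∀

pos-^ : ∀ m k → (+ m) ^ k ≡ + (m ℕ.^ k)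
pos-^ m ℕ.zero    = refl
pos-^ m (ℕ.suc k) = trans (cong (+ m *_) (pos-^ m k)) (sym (ℤ.pos-* m (m ℕ.^ k)))

evalList-cong : ∀ {m x y} cs → x ≡ y mod m → evalList cs x ≡ evalList cs y mod m
evalList-cong []       x≡y = ≡⇒≡-mod refl
evalList-cong (c ∷ cs) x≡y = +-cong-mod (≡-mod-refl c) (*-cong-mod x≡y (evalList-cong cs x≡y))

-- hom k B u v is the homogenisation v^k B(u/v); multiplying by s^k with s ≡ v⁻¹ undoes it.
s^k*hom≡evalMonic[s*u] : ∀ {m s u v k} → s * v ≡ 1ℤ mod m → (bs : Vec ℤ k) →
  s ^ k * hom k (monicCoeffs bs) u v ≡ evalMonic bs (s * u) mod m
s^k*hom≡evalMonic[s*u] {s = s} {u} sv≡1 [] = ≡⇒≡-mod (constant s u)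
  where
  constant : ∀ s u → 1ℤ * (1ℤ * 1ℤ + u * 0ℤ) ≡ 1ℤ + s * u * 0ℤ
  constant = solve-∀
s^k*hom≡evalMonic[s*u] {m} {s} {u} {v} {ℕ.suc k} sv≡1 (b ∷ bs) = begin
  s ^ ℕ.suc k * (b * v ^ ℕ.suc k + u * H)   ≡⟨ regroup s (s ^ k) b v (v ^ k) u H ⟩
  b * (s * v * (s ^ k * v ^ k)) + s * u * (s ^ k * H)
    ≡⟨ cong (λ t → b * (s * v * t) + s * u * (s ^ k * H)) (sym (^-distribʳ-* s v k)) ⟩
  b * (s * v) ^ ℕ.suc k + s * u * (s ^ k * H)
    ≈⟨ +-cong-mod (*-cong-mod (≡-mod-refl b) (^-cong-mod (ℕ.suc k) sv≡1))
                  (*-cong-mod (≡-mod-refl (s * u)) (s^k*hom≡evalMonic[s*u] {m} {s} {u} {v} sv≡1 bs)) ⟩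
  b * 1ℤ ^ ℕ.suc k + s * u * evalMonic bs (s * u)
    ≡⟨ cong (λ t → b * t + s * u * evalMonic bs (s * u)) (ℤ.^-zeroˡ (ℕ.suc k)) ⟩
  b * 1ℤ + s * u * evalMonic bs (s * u)
    ≡⟨ cong (_+ s * u * evalMonic bs (s * u)) (ℤ.*-identityʳ b) ⟩
  evalMonic (b ∷ bs) (s * u) ∎
  where
  open ≡-mod-Reasoning m
  H : ℤ
  H = hom k (monicCoeffs bs) u v
  regroup : ∀ s S b v V u H →
    s * S * (b * (v * V) + u * H) ≡ b * (s * v * (S * V)) + s * u * (S * H)
  regroup = solve-∀

hom≡u^k : ∀ {m u v k} → m ∣ v → (bs : Vec ℤ k) → hom k (monicCoeffs bs) u v ≡ u ^ k mod m
hom≡u^k {u = u} m∣v [] = ≡⇒≡-mod (constant u)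
  where
  constant : ∀ u → 1ℤ * 1ℤ + u * 0ℤ ≡ 1ℤ
  constant = solve-∀
hom≡u^k {m} {u} {v} {ℕ.suc k} m∣v (b ∷ bs) = begin
  b * v ^ ℕ.suc k + u * hom k (monicCoeffs bs) u v
    ≈⟨ +-cong-mod (∣⇒≡0-mod (∣n⇒∣m*n b (∣m⇒∣m*n (v ^ k) m∣v)))
                  (*-cong-mod (≡-mod-refl u) (hom≡u^k {m} {u} {v} m∣v bs)) ⟩
  0ℤ + u ^ ℕ.suc k ≡⟨ ℤ.+-identityˡ (u ^ ℕ.suc k) ⟩
  u ^ ℕ.suc k ∎
  where open ≡-mod-Reasoning m

prime∣*⇒∣⊎∣ : ∀ {p} i j → Prime p → + p ∣ i * j → (+ p ∣ i) ⊎ (+ p ∣ j)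
prime∣*⇒∣⊎∣ i j pr p∣ij with euclidsLemma ∣ i ∣ ∣ j ∣ pr (subst (_ ℕ.∣_) (ℤ.abs-* i j) (∣⇒∣ᵤ p∣ij))
... | inj₁ p∣i = inj₁ (∣ᵤ⇒∣ p∣i)
... | inj₂ p∣j = inj₂ (∣ᵤ⇒∣ p∣j)

prime∣^⇒∣ : ∀ {p} i k → Prime p → + p ∣ i ^ k → + p ∣ i
prime∣^⇒∣ i ℕ.zero    pr p∣1 = contradiction (subst Prime (ℕ.∣1⇒≡1 (∣⇒∣ᵤ p∣1)) pr) ¬prime[1]
prime∣^⇒∣ i (ℕ.suc k) pr p∣i^k with prime∣*⇒∣⊎∣ i (i ^ k) pr p∣i^k
... | inj₁ p∣i   = p∣i
... | inj₂ p∣i^k = prime∣^⇒∣ i k pr p∣i^k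

prime∤⇒coprime : ∀ {p a} → Prime p → ¬ p ℕ.∣ a → Coprime a p
prime∤⇒coprime pr p∤a (i∣a , i∣p) with prime⇒irreducible pr i∣p
... | inj₁ i≡1 = i≡1
... | inj₂ refl = contradiction i∣a p∤a

coprime-* : ∀ {a m n} → Coprime a m → Coprime a n → Coprime a (m ℕ.* n)
coprime-* {m = m} a⊥m a⊥n {i} (i∣a , i∣mn) = a⊥n (i∣a , coprime-divisor i⊥m i∣mn)
  where
  i⊥m : Coprime i m
  i⊥m (j∣i , j∣m) = a⊥m (ℕ.∣-trans j∣i i∣a , j∣m)

coprime-^ : ∀ {a m} k → Coprime a m → Coprime a (m ℕ.^ k)
coprime-^ {a} ℕ.zero    a⊥m = Coprimality.sym (Coprimality.1-coprimeTo a)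
coprime-^     (ℕ.suc k) a⊥m = coprime-* a⊥m (coprime-^ k a⊥m)

pos-1+*≡* : ∀ u v w z → 1 ℕ.+ u ℕ.* v ≡ w ℕ.* z → 1ℤ + + u * + v ≡ + w * + z
pos-1+*≡* u v w z eq =
  trans (cong (λ t → 1ℤ + t) (sym (ℤ.pos-* u v))) (trans (cong +_ eq) (ℤ.pos-* w z))

coprime⇒invertible-ℕ : ∀ a n → Coprime a n → Σ ℤ λ s → s * + a ≡ 1ℤ mod + n
coprime⇒invertible-ℕ a n a⊥n with coprime-Bézout a⊥n
... | ℕ.Bézout.+- x y 1+yn≡xa = + x , ∣⇒≡-mod (divides (+ y) (begin
  + x * + a - 1ℤ            ≡⟨ cong (_- 1ℤ) (sym (pos-1+*≡* y n x a 1+yn≡xa)) ⟩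
  (1ℤ + + y * + n) - 1ℤ     ≡⟨ cancel (+ y * + n) ⟩
  + y * + n                 ∎))
  where
  open ≡-Reasoning
  cancel : ∀ t → (1ℤ + t) - 1ℤ ≡ t
  cancel = solve-∀
... | ℕ.Bézout.-+ x y 1+xa≡yn = - + x , ∣⇒≡-mod (divides (- + y) (begin
  - + x * + a - 1ℤ          ≡⟨ negate (+ x) (+ a) ⟩
  - (1ℤ + + x * + a)        ≡⟨ cong -_ (pos-1+*≡* x a y n 1+xa≡yn) ⟩
  - (+ y * + n)             ≡⟨ ℤ.neg-distribˡ-* (+ y) (+ n) ⟩
  - + y * + n               ∎))
  where
  open ≡-Reasoning
  negate : ∀ x a → - x * a - 1ℤ ≡ - (1ℤ + x * a)
  negate = solve-∀

coprime⇒invertible : ∀ a n → Coprime ∣ a ∣ n → Σ ℤ λ s → s * a ≡ 1ℤ mod + n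
coprime⇒invertible (+ a)    n a⊥n = coprime⇒invertible-ℕ a n a⊥n
coprime⇒invertible -[1+ a ] n a⊥n with coprime⇒invertible-ℕ (ℕ.suc a) n a⊥n
... | s , sa≡1 = - s , subst (λ t → t ≡ 1ℤ mod + n) (neg-*-neg s (+ ℕ.suc a)) sa≡1
  where
  neg-*-neg : ∀ s a → s * a ≡ - s * - a
  neg-*-neg = solve-∀

gcd[gcd[x,y],m]≡gcd[z,m] : ∀ {x y z m} →
  (∀ {d} → d ∣ m → d ∣ x → d ∣ z) →
  (∀ {d} → d ∣ m → d ∣ z → (d ∣ x) × (d ∣ y)) →
  gcd (gcd x y) m ≡ gcd z m
gcd[gcd[x,y],m]≡gcd[z,m] {x} {y} {z} {m} x⇒z z⇒x×y = cong +_ (ℕ.∣-antisym G₁∣G₂ G₂∣G₁)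
  where
  G₁∣m : gcd (gcd x y) m Unsigned.∣ m
  G₁∣m = ℤ.gcd[i,j]∣j (gcd x y) m
  G₁∣x : gcd (gcd x y) m Unsigned.∣ x
  G₁∣x = ℕ.∣-trans (ℤ.gcd[i,j]∣i (gcd x y) m) (ℤ.gcd[i,j]∣i x y)
  G₁∣G₂ : gcd (gcd x y) m Unsigned.∣ gcd z m
  G₁∣G₂ = ℤ.gcd-greatest {z} {m} {gcd (gcd x y) m}
    (∣⇒∣ᵤ (x⇒z (∣ᵤ⇒∣ {gcd (gcd x y) m} G₁∣m) (∣ᵤ⇒∣ {gcd (gcd x y) m} G₁∣x))) G₁∣m
  G₂∣m : gcd z m Unsigned.∣ m
  G₂∣m = ℤ.gcd[i,j]∣j z m
  G₂∣x×y : (gcd z m ∣ x) × (gcd z m ∣ y)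
  G₂∣x×y = z⇒x×y (∣ᵤ⇒∣ {gcd z m} G₂∣m) (∣ᵤ⇒∣ {gcd z m} (ℤ.gcd[i,j]∣i z m))
  G₂∣G₁ : gcd z m Unsigned.∣ gcd (gcd x y) m
  G₂∣G₁ = ℤ.gcd-greatest {gcd x y} {m} {gcd z m}
    (ℤ.gcd-greatest {x} {y} {gcd z m} (∣⇒∣ᵤ (proj₁ G₂∣x×y)) (∣⇒∣ᵤ (proj₂ G₂∣x×y))) G₂∣m

gcd-pattern : ∀ a₁ a₀ cs {q s c} → s * a₁ ≡ 1ℤ mod q →
  q ∣ evalLin a₁ a₀ c → q ∣ evalList cs c →
  ∀ n → gcd (gcd (evalLin a₁ a₀ n) (evalList cs n)) q ≡ gcd (n - c) q
gcd-pattern a₁ a₀ cs {q} {s} {c} sa₁≡1 q∣A[c] q∣B[c] n =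
  gcd[gcd[x,y],m]≡gcd[z,m] A[n]⇒n-c n-c⇒A[n]×B[n]
  where
  A[n]≡a₁[n-c] : evalLin a₁ a₀ n ≡ a₁ * (n - c) mod q
  A[n]≡a₁[n-c] = ∣⇒≡-mod (subst (q ∣_) (shift a₁ a₀ n c) q∣A[c])
    where
    shift : ∀ a₁ a₀ n c → a₁ * c + a₀ ≡ (a₁ * n + a₀) - a₁ * (n - c)
    shift = solve-∀

  n-c≡s*A[n] : n - c ≡ s * evalLin a₁ a₀ n mod q
  n-c≡s*A[n] = begin
    n - c                 ≡⟨ ℤ.*-identityˡ (n - c) ⟨
    1ℤ * (n - c)          ≈⟨ *-cong-mod (≡-mod-sym sa₁≡1) (≡-mod-refl (n - c)) ⟩
    s * a₁ * (n - c)      ≡⟨ ℤ.*-assoc s a₁ (n - c) ⟩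
    s * (a₁ * (n - c))    ≈⟨ *-cong-mod (≡-mod-refl s) (≡-mod-sym A[n]≡a₁[n-c]) ⟩
    s * evalLin a₁ a₀ n   ∎
    where open ≡-mod-Reasoning q

  A[n]⇒n-c : ∀ {d} → d ∣ q → d ∣ evalLin a₁ a₀ n → d ∣ n - c
  A[n]⇒n-c d∣q d∣A[n] =
    ∣-resp-≡-mod (≡-mod-weaken d∣q (≡-mod-sym n-c≡s*A[n])) (∣n⇒∣m*n s d∣A[n])

  n-c⇒A[n]×B[n] : ∀ {d} → d ∣ q → d ∣ n - c → (d ∣ evalLin a₁ a₀ n) × (d ∣ evalList cs n)
  n-c⇒A[n]×B[n] d∣q d∣n-c =
    ∣-resp-≡-mod (≡-mod-weaken d∣q (≡-mod-sym A[n]≡a₁[n-c])) (∣n⇒∣m*n a₁ d∣n-c) ,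
    ∣-resp-≡-mod (evalList-cong cs (≡-mod-sym (∣⇒≡-mod d∣n-c))) (∣-trans d∣q q∣B[c])

prime∣resultant⇒∤leading : ∀ {p a₁ a₀ e} (bs : Vec ℤ e) → Prime p → gcd a₀ a₁ ≡ 1ℤ →
  + p ∣ resultant a₁ a₀ bs → ¬ (+ p ∣ a₁)
prime∣resultant⇒∤leading {p} {a₁} {a₀} {e} bs pr a₀⊥a₁ p∣Δ p∣a₁ = ¬prime[1] (subst Prime p≡1 pr)
  where
  p∣[-a₀]^e : + p ∣ (- a₀) ^ e
  p∣[-a₀]^e = ∣-resp-≡-mod (hom≡u^k p∣a₁ bs) p∣Δ
  p∣a₀ : + p ∣ a₀
  p∣a₀ = subst (_ ∣_) (ℤ.neg-involutive a₀) (∣m⇒∣-m (prime∣^⇒∣ (- a₀) e pr p∣[-a₀]^e))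
  p≡1 : p ≡ 1
  p≡1 = ℕ.∣1⇒≡1 (subst (p ℕ.∣_) (cong ∣_∣ a₀⊥a₁)
    (ℤ.gcd-greatest {a₀} {a₁} {+ p} (∣⇒∣ᵤ p∣a₀) (∣⇒∣ᵤ p∣a₁)))

leading-invertible : ∀ {p a₁ a₀ e} (bs : Vec ℤ e) → Prime p → gcd a₀ a₁ ≡ 1ℤ →
  ∀ ω → (+ p) ^ ω ∣ resultant a₁ a₀ bs → Σ ℤ λ s → s * a₁ ≡ 1ℤ mod (+ p) ^ ω
leading-invertible {p} {a₁} {a₀} bs pr a₀⊥a₁ ω q∣Δ =
  subst (λ q → Σ ℤ λ s → s * a₁ ≡ 1ℤ mod q) (sym (pos-^ p ω))
        (coprime⇒invertible a₁ (p ℕ.^ ω) (a₁⊥p^ω ω q∣Δ))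
  where
  a₁⊥p^ω : ∀ k → (+ p) ^ k ∣ resultant a₁ a₀ bs → Coprime ∣ a₁ ∣ (p ℕ.^ k)
  a₁⊥p^ω ℕ.zero    _   = Coprimality.sym (Coprimality.1-coprimeTo ∣ a₁ ∣)
  a₁⊥p^ω (ℕ.suc k) q∣Δ = coprime-^ (ℕ.suc k) (prime∤⇒coprime pr λ p∣a₁ →
    prime∣resultant⇒∤leading bs pr a₀⊥a₁ (∣-trans (∣m⇒∣m*n _ ∣-refl) q∣Δ) (∣ᵤ⇒∣ p∣a₁))

proposition9 : (a₁ a₀ : ℤ) → ¬ (a₁ ≡ 0ℤ) → gcd a₀ a₁ ≡ 1ℤ →
    (e : ℕ) → (bs : Vec ℤ e) → CoprimeLinMonic a₁ a₀ bs →
    (p : ℕ) → Prime p → (ω : ℕ) → IsValuation p (resultant a₁ a₀ bs) ω →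
    Σ ℤ λ c → ∀ (n : ℤ) →
      gcd (gcd (evalLin a₁ a₀ n) (evalMonic bs n)) ((+ p) ^ ω) ≡ gcd (n - c) ((+ p) ^ ω)
proposition9 a₁ a₀ _ a₀⊥a₁ e bs _ p pr ω (q∣Δ , _) =
  c , gcd-pattern a₁ a₀ (monicCoeffs bs) {s = s} {c = c} sa₁≡1 q∣A[c] q∣B[c]
  where
  inverse : Σ ℤ λ s → s * a₁ ≡ 1ℤ mod (+ p) ^ ω
  inverse = leading-invertible bs pr a₀⊥a₁ ω (∣ᵤ⇒∣ q∣Δ)
  s : ℤ
  s = proj₁ inverse
  sa₁≡1 : s * a₁ ≡ 1ℤ mod (+ p) ^ ω
  sa₁≡1 = proj₂ inverse
  c : ℤ
  c = s * - a₀
  q∣A[c] : (+ p) ^ ω ∣ evalLin a₁ a₀ c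
  q∣A[c] = subst (_ ∣_) (root a₁ a₀ s) (∣n⇒∣m*n (- a₀) (≡-mod⇒∣ sa₁≡1))
    where
    root : ∀ a₁ a₀ s → - a₀ * (s * a₁ - 1ℤ) ≡ a₁ * (s * - a₀) + a₀
    root = solve-∀
  q∣B[c] : (+ p) ^ ω ∣ evalMonic bs c
  q∣B[c] = ∣-resp-≡-mod (s^k*hom≡evalMonic[s*u] sa₁≡1 bs) (∣n⇒∣m*n (s ^ e) (∣ᵤ⇒∣ q∣Δ))
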